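{- Let $(P,l,r)$ be a pullback in $\mathbf{Gpd}$ of a cospan $S\xrightarrow{u}B\xleftarrow{v}T$, regarded as a pseudocone with identity $2$-cell. It is a bipullback if and only if the following condition holds: for every groupoid $X$ and every pseudocone $(l',r',\nu)$ with vertex $X$, there exist a functor $h:X\to P$ and natural transformations $\alpha:l'\Rightarrow l\circ h$ and $\beta:r\circ h\Rightarrow r'$ such that $\nu=(v\beta)\circ(u\alpha)$.
   Context: $\mathbf{Gpd}$ is the $2$-category of small groupoids, functors and natural transformations. For a cospan $S\xrightarrow{u}B\xleftarrow{v}T$: - A pseudocone with vertex $X$ is $(l',r',\nu)$ with $l':X\to S$, $r':X\to T$ and $\nu:ul'\Rightarrow vr'$. - A morphism $(l',r',\nu)\to(l'',r'',\nu'')$ is $(\alpha:l'\Rightarrow l'',\beta:r'\Rightarrow r'')$ with $\nu''\circ(u\alpha)=(v\beta)\circ\nu$. - A pseudocone $(P,l,r,\mu)$ is a bipullback if for every groupoid $X$ the functor $\mathbf{Gpd}(X,P)\to\{\text{pseudocones with vertex }X\}$, $h\mapsto(lh,rh,\mu h)$, $\theta\mapsto(l\theta,r\theta)$, is an equivalence of categories. -}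

module Defs where

open import Level using (Level; _⊔_) renaming (suc to lsuc)
open import Relation.Binary.PropositionalEquality using (_≡_; refl)
import Relation.Binary.Structures as RBS
open import Data.Product using (Σ; _×_; _,_; Σ-syntax)

record Groupoid (o ℓ e : Level) : Set (lsuc (o ⊔ ℓ ⊔ e)) where
  infix  4 _≈_
  infixr 9 _∘_
  field
    Obj  : Set o
    _⇒_  : Obj → Obj → Set ℓ
    _≈_  : ∀ {A B} → A ⇒ B → A ⇒ B → Set e
    id   : ∀ {A} → A ⇒ A
    _∘_  : ∀ {A B C} → B ⇒ C → A ⇒ B → A ⇒ C
    _⁻¹  : ∀ {A B} → A ⇒ B → B ⇒ A
    equiv     : ∀ {A B} → RBS.IsEquivalence (_≈_ {A} {B})
    assoc     : ∀ {A B C D} {f : A ⇒ B} {g : B ⇒ C} {h : C ⇒ D} →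
                (h ∘ g) ∘ f ≈ h ∘ (g ∘ f)
    identityˡ : ∀ {A B} {f : A ⇒ B} → id ∘ f ≈ f
    identityʳ : ∀ {A B} {f : A ⇒ B} → f ∘ id ≈ f
    ∘-resp-≈  : ∀ {A B C} {f h : B ⇒ C} {g i : A ⇒ B} →
                f ≈ h → g ≈ i → f ∘ g ≈ h ∘ i
    inverseˡ  : ∀ {A B} {f : A ⇒ B} → (f ⁻¹) ∘ f ≈ id
    inverseʳ  : ∀ {A B} {f : A ⇒ B} → f ∘ (f ⁻¹) ≈ id


module _ {o ℓ e} (C : Groupoid o ℓ e) where
  open Groupoid C
  idTo : ∀ {a b : Obj} → a ≡ b → a ⇒ b
  idTo refl = id

record Functor {o ℓ e} (C D : Groupoid o ℓ e) : Set (o ⊔ ℓ ⊔ e) where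
  private
    module C = Groupoid C
    module D = Groupoid D
  field
    F₀ : C.Obj → D.Obj
    F₁ : ∀ {A B} → A C.⇒ B → F₀ A D.⇒ F₀ B
    identity     : ∀ {A} → F₁ (C.id {A}) D.≈ D.id
    homomorphism : ∀ {A B E} {f : A C.⇒ B} {g : B C.⇒ E} →
                   F₁ (g C.∘ f) D.≈ F₁ g D.∘ F₁ f
    F-resp-≈     : ∀ {A B} {f g : A C.⇒ B} → f C.≈ g → F₁ f D.≈ F₁ g

open Functor public

_∘F_ : ∀ {o ℓ e} {C D E : Groupoid o ℓ e} → Functor D E → Functor C D → Functor C E
_∘F_ {C = C} {D} {E} G F = record
  { F₀ = λ x → F₀ G (F₀ F x)
  ; F₁ = λ f → F₁ G (F₁ F f)
  ; identity = E.trans (F-resp-≈ G (identity F)) (identity G)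
  ; homomorphism = E.trans (F-resp-≈ G (homomorphism F)) (homomorphism G)
  ; F-resp-≈ = λ p → F-resp-≈ G (F-resp-≈ F p)
  }
  where module E {A B} = RBS.IsEquivalence (Groupoid.equiv E {A} {B})

record NatTrans {o ℓ e} {C D : Groupoid o ℓ e} (F G : Functor C D) : Set (o ⊔ ℓ ⊔ e) where
  private
    module C = Groupoid C
    module D = Groupoid D
  field
    η       : ∀ x → F₀ F x D.⇒ F₀ G x
    commute : ∀ {x y} (f : x C.⇒ y) → η y D.∘ F₁ F f D.≈ F₁ G f D.∘ η x

open NatTrans public

_≈NT_ : ∀ {o ℓ e} {C D : Groupoid o ℓ e} {F G : Functor C D} →
        NatTrans F G → NatTrans F G → Set (o ⊔ e)
_≈NT_ {C = C} {D} α β = ∀ x → Groupoid._≈_ D (η α x) (η β x)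

-- Strict equality of functors F = G (equality in the 1-category Gpd):
-- equal on objects, and equal on morphisms modulo the identification of
-- objects (i.e. F₁ f transported along eq₀ is G₁ f).
record StrictEq {o ℓ e} {C D : Groupoid o ℓ e} (F G : Functor C D) : Set (o ⊔ ℓ ⊔ e) where
  private
    module C = Groupoid C
    module D = Groupoid D
  field
    eq₀ : ∀ x → F₀ F x ≡ F₀ G x
    eq₁ : ∀ {x y} (f : x C.⇒ y) →
          idTo D (eq₀ y) D.∘ F₁ F f D.≈ F₁ G f D.∘ idTo D (eq₀ x)

open StrictEq public

idNT : ∀ {o ℓ e} {C D : Groupoid o ℓ e} {F G : Functor C D} →
       StrictEq F G → NatTrans F G
idNT {D = D} p = record { η = λ x → idTo D (eq₀ p x) ; commute = eq₁ p }

_▹_ : ∀ {o ℓ e} {X C D : Groupoid o ℓ e} {F G : Functor C D} →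
      NatTrans F G → (h : Functor X C) → NatTrans (F ∘F h) (G ∘F h)
μ ▹ h = record { η = λ x → η μ (F₀ h x) ; commute = λ f → commute μ (F₁ h f) }

module _ {o ℓ e} {S B T : Groupoid o ℓ e} (u : Functor S B) (v : Functor T B) where
  private
    module B = Groupoid B

  record PseudoCone (X : Groupoid o ℓ e) : Set (o ⊔ ℓ ⊔ e) where
    constructor pcone
    field
      l′ : Functor X S
      r′ : Functor X T
      ν  : NatTrans (u ∘F l′) (v ∘F r′)

  open PseudoCone public

  record ConeMor {X : Groupoid o ℓ e} (c c′ : PseudoCone X) : Set (o ⊔ ℓ ⊔ e) where
    field
      α : NatTrans (l′ c) (l′ c′)
      β : NatTrans (r′ c) (r′ c′)
      compat : ∀ x → η (ν c′) x B.∘ F₁ u (η α x) B.≈ F₁ v (η β x) B.∘ η (ν c) x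

  open ConeMor public

  record ConeIso {X : Groupoid o ℓ e} (c c′ : PseudoCone X) : Set (o ⊔ ℓ ⊔ e) where
    field
      to   : ConeMor c c′
      from : ConeMor c′ c
      isoˡ : ∀ x → Groupoid._≈_ S (Groupoid._∘_ S (η (α from) x) (η (α to) x)) (Groupoid.id S)
      isoʳ : ∀ x → Groupoid._≈_ S (Groupoid._∘_ S (η (α to) x) (η (α from) x)) (Groupoid.id S)
      isoˡ′ : ∀ x → Groupoid._≈_ T (Groupoid._∘_ T (η (β from) x) (η (β to) x)) (Groupoid.id T)
      isoʳ′ : ∀ x → Groupoid._≈_ T (Groupoid._∘_ T (η (β to) x) (η (β from) x)) (Groupoid.id T)

  record IsPullback (P : Groupoid o ℓ e) (l : Functor P S) (r : Functor P T)
         : Set (lsuc (o ⊔ ℓ ⊔ e)) where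
    field
      commutes  : StrictEq (u ∘F l) (v ∘F r)
      universal : ∀ (X : Groupoid o ℓ e) (l″ : Functor X S) (r″ : Functor X T) →
                  StrictEq (u ∘F l″) (v ∘F r″) →
                  Σ[ h ∈ Functor X P ]
                    StrictEq (l ∘F h) l″ × StrictEq (r ∘F h) r″ ×
                    (∀ (h′ : Functor X P) → StrictEq (l ∘F h′) l″ →
                       StrictEq (r ∘F h′) r″ → StrictEq h′ h)

  -- A pseudocone (P , l , r , μ) is a bipullback if for every X the functor
  --   Φ : Gpd(X,P) → PseudoCones(X),  h ↦ (l h , r h , μ h),  θ ↦ (l θ , r θ)
  -- is an equivalence of categories, i.e. fully faithful and (split)
  -- essentially surjective.
  module _ {P : Groupoid o ℓ e} (l : Functor P S) (r : Functor P T)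
           (μ : NatTrans (u ∘F l) (v ∘F r)) where

    Φ₀ : ∀ {X : Groupoid o ℓ e} → Functor X P → PseudoCone X
    Φ₀ h = pcone (l ∘F h) (r ∘F h)
            (record { η = λ x → η μ (F₀ h x) ; commute = λ f → commute μ (F₁ h f) })

    record IsBipullback : Set (lsuc (o ⊔ ℓ ⊔ e)) where
      field
        essSurj  : ∀ (X : Groupoid o ℓ e) (c : PseudoCone X) →
                   Σ[ h ∈ Functor X P ] ConeIso (Φ₀ h) c
        full     : ∀ (X : Groupoid o ℓ e) (h h′ : Functor X P)
                   (m : ConeMor (Φ₀ h) (Φ₀ h′)) →
                   Σ[ θ ∈ NatTrans h h′ ]
                     ((∀ x → Groupoid._≈_ S (F₁ l (η θ x)) (η (α m) x)) ×
                      (∀ x → Groupoid._≈_ T (F₁ r (η θ x)) (η (β m) x)))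
        faithful : ∀ (X : Groupoid o ℓ e) (h h′ : Functor X P)
                   (θ θ′ : NatTrans h h′) →
                   (∀ x → Groupoid._≈_ S (F₁ l (η θ x)) (F₁ l (η θ′ x))) →
                   (∀ x → Groupoid._≈_ T (F₁ r (η θ x)) (F₁ r (η θ′ x))) →
                   θ ≈NT θ′

    -- the condition of the proposition: for every pseudocone (l′,r′,ν) there
    -- are h, α : l′ ⇒ l h, β : r h ⇒ r′ with ν = (v β) ∘ μh ∘ (u α)
    -- (μ is the identity 2-cell in the case of interest)
    LiftCondition : Set (lsuc (o ⊔ ℓ ⊔ e))
    LiftCondition =
      ∀ (X : Groupoid o ℓ e) (c : PseudoCone X) →
        Σ[ h ∈ Functor X P ] Σ[ a ∈ NatTrans (l′ c) (l ∘F h) ] Σ[ b ∈ NatTrans (r ∘F h) (r′ c) ]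
          (∀ x → η (ν c) x B.≈ F₁ v (η b x) B.∘ (η μ (F₀ h x) B.∘ F₁ u (η a x)))

{-# OPTIONS --safe #-}
-- One direction needs no pullback: an isomorphism of pseudocones Φ h ≅ (l′, r′, ν) supplies
-- α and β, and its compatibility condition is the equation ν = (v β) ∘ (u α); conversely
-- such a factorisation, with α inverted, is such an isomorphism. What remains is that Φ is
-- fully faithful, which holds for any strict pullback: functors out of the interval
-- groupoid (the free-living isomorphism) are single morphisms, so the universal property
-- and its uniqueness clause make (l, r) jointly injective on objects, jointly faithful, and
-- jointly full on pairs of morphisms that agree over B.
module Submission where

open import Data.Bool using (Bool; true; false)
open import Data.Product using (_×_; _,_; proj₁; proj₂; Σ-syntax; ∃-syntax)
open import Data.Unit using (⊤; tt)
open import Function.Bundles using (_⇔_; mk⇔)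
open import Level using (Lift; lift; _⊔_)
open import Relation.Binary.Bundles using (Setoid)
open import Relation.Binary.PropositionalEquality as ≡ using (_≡_; refl; subst₂)
import Relation.Binary.Reasoning.Setoid as SetoidReasoning
open import Relation.Binary.Structures using (IsEquivalence)

open import Defs

module GroupoidProperties {o ℓ e} (C : Groupoid o ℓ e) where
  open Groupoid C public

  hom-setoid : Obj → Obj → Setoid ℓ e
  hom-setoid A B = record { isEquivalence = equiv {A} {B} }

  module HomReasoning {A B : Obj} = SetoidReasoning (hom-setoid A B)
  module Equiv {A B : Obj} = IsEquivalence (equiv {A} {B})
  open Equiv public using () renaming (refl to ≈-refl; sym to ≈-sym; trans to ≈-trans)
  open HomReasoning

  ∘-resp-≈ˡ : ∀ {A B D} {f h : B ⇒ D} {g : A ⇒ B} → f ≈ h → f ∘ g ≈ h ∘ g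
  ∘-resp-≈ˡ p = ∘-resp-≈ p ≈-refl

  ∘-resp-≈ʳ : ∀ {A B D} {f : B ⇒ D} {g i : A ⇒ B} → g ≈ i → f ∘ g ≈ f ∘ i
  ∘-resp-≈ʳ p = ∘-resp-≈ ≈-refl p

  sym-assoc : ∀ {A B D E} {f : A ⇒ B} {g : B ⇒ D} {h : D ⇒ E} → h ∘ (g ∘ f) ≈ (h ∘ g) ∘ f
  sym-assoc = ≈-sym assoc

  cancelʳ : ∀ {A B D} {f : B ⇒ D} {g : A ⇒ B} → (f ∘ g) ∘ g ⁻¹ ≈ f
  cancelʳ {f = f} {g} = begin
    (f ∘ g) ∘ g ⁻¹  ≈⟨ assoc ⟩
    f ∘ (g ∘ g ⁻¹)  ≈⟨ ∘-resp-≈ʳ inverseʳ ⟩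
    f ∘ id          ≈⟨ identityʳ ⟩
    f               ∎

  cancelˡ : ∀ {A B D} {f : A ⇒ B} {g : B ⇒ D} → g ⁻¹ ∘ (g ∘ f) ≈ f
  cancelˡ {f = f} {g} = begin
    g ⁻¹ ∘ (g ∘ f)  ≈⟨ sym-assoc ⟩
    (g ⁻¹ ∘ g) ∘ f  ≈⟨ ∘-resp-≈ˡ inverseˡ ⟩
    id ∘ f          ≈⟨ identityˡ ⟩
    f               ∎

  inverse-unique : ∀ {A B} {f : A ⇒ B} {g : B ⇒ A} → g ∘ f ≈ id → g ≈ f ⁻¹
  inverse-unique {f = f} {g} p = begin
    g                ≈⟨ cancelʳ ⟨
    (g ∘ f) ∘ f ⁻¹   ≈⟨ ∘-resp-≈ˡ p ⟩
    id ∘ f ⁻¹        ≈⟨ identityˡ ⟩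
    f ⁻¹             ∎

  ⁻¹-square : ∀ {A B A′ B′} {x : A ⇒ A′} {y : B ⇒ B′} {f : A ⇒ B} {g : A′ ⇒ B′} →
              y ∘ f ≈ g ∘ x → y ⁻¹ ∘ g ≈ f ∘ x ⁻¹
  ⁻¹-square {x = x} {y} {f} {g} p = begin
    y ⁻¹ ∘ g                  ≈⟨ ∘-resp-≈ʳ cancelʳ ⟨
    y ⁻¹ ∘ ((g ∘ x) ∘ x ⁻¹)   ≈⟨ ∘-resp-≈ʳ (∘-resp-≈ˡ p) ⟨
    y ⁻¹ ∘ ((y ∘ f) ∘ x ⁻¹)   ≈⟨ ∘-resp-≈ʳ assoc ⟩
    y ⁻¹ ∘ (y ∘ (f ∘ x ⁻¹))   ≈⟨ cancelˡ ⟩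
    f ∘ x ⁻¹                  ∎

  id-square : ∀ {A B} {f g : A ⇒ B} → f ≈ g → id ∘ f ≈ g ∘ id
  id-square p = ≈-trans identityˡ (≈-trans p (≈-sym identityʳ))

  idTo-square-ids : ∀ {A B} {f : A ⇒ A} {g : B ⇒ B} (d : A ≡ B) →
                    f ≈ id → g ≈ id → idTo C d ∘ f ≈ g ∘ idTo C d
  idTo-square-ids {f = f} {g} d p q = begin
    idTo C d ∘ f   ≈⟨ ∘-resp-≈ʳ p ⟩
    idTo C d ∘ id  ≈⟨ identityʳ ⟩
    idTo C d       ≈⟨ identityˡ ⟨
    id ∘ idTo C d  ≈⟨ ∘-resp-≈ˡ q ⟨
    g ∘ idTo C d   ∎

  idTo-square-unique : ∀ {p q p′ q′} {f g : p ⇒ q} {k : p′ ⇒ q′} (a a′ : p ≡ p′) (b b′ : q ≡ q′) →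
                       idTo C b ∘ f ≈ k ∘ idTo C a → idTo C b′ ∘ g ≈ k ∘ idTo C a′ → f ≈ g
  idTo-square-unique refl refl refl refl p q =
    ≈-trans (≈-sym identityˡ) (≈-trans p (≈-trans (≈-sym q) identityˡ))

module FunctorProperties {o ℓ e} {C D : Groupoid o ℓ e} (F : Functor C D) where
  private
    module C = GroupoidProperties C
    module D = GroupoidProperties D
  open D using (_≈_; _∘_; _⁻¹; id)
  open D.HomReasoning

  F-inverseʳ : ∀ {A B} {f : A C.⇒ B} → F₁ F f ∘ F₁ F (f C.⁻¹) ≈ id
  F-inverseʳ {f = f} = begin
    F₁ F f ∘ F₁ F (f C.⁻¹)  ≈⟨ homomorphism F ⟨
    F₁ F (f C.∘ f C.⁻¹)     ≈⟨ F-resp-≈ F C.inverseʳ ⟩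
    F₁ F C.id               ≈⟨ identity F ⟩
    id                      ∎

  F-inverseˡ : ∀ {A B} {f : A C.⇒ B} → F₁ F (f C.⁻¹) ∘ F₁ F f ≈ id
  F-inverseˡ {f = f} = begin
    F₁ F (f C.⁻¹) ∘ F₁ F f  ≈⟨ homomorphism F ⟨
    F₁ F (f C.⁻¹ C.∘ f)     ≈⟨ F-resp-≈ F C.inverseˡ ⟩
    F₁ F C.id               ≈⟨ identity F ⟩
    id                      ∎

  F-resp-⁻¹ : ∀ {A B} {f : A C.⇒ B} → F₁ F (f C.⁻¹) ≈ F₁ F f ⁻¹
  F-resp-⁻¹ = D.inverse-unique F-inverseˡ

  -- Matching σ₀ and σ₁ against refl uses K: objects are assumed to form sets.
  F₁-subst₂ : ∀ {a b a′ b′} (d₀ : a ≡ a′) (d₁ : b ≡ b′) {m : a C.⇒ b} {s : F₀ F a′ D.⇒ F₀ F b′}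
              (σ₀ : F₀ F a ≡ F₀ F a′) (σ₁ : F₀ F b ≡ F₀ F b′) →
              idTo D σ₁ ∘ F₁ F m ≈ s ∘ idTo D σ₀ → F₁ F (subst₂ C._⇒_ d₀ d₁ m) ≈ s
  F₁-subst₂ refl refl refl refl p = D.≈-trans (D.≈-sym D.identityˡ) (D.≈-trans p D.identityʳ)

  lift-naturality : ∀ {X : Groupoid o ℓ e} {h h′ : Functor X C} (α : NatTrans (F ∘F h) (F ∘F h′))
                    (θ : ∀ x → F₀ h x C.⇒ F₀ h′ x) → (∀ x → F₁ F (θ x) ≈ η α x) →
                    ∀ {x y} (f : Groupoid._⇒_ X x y) →
                    F₁ F (θ y C.∘ F₁ h f) ≈ F₁ F (F₁ h′ f C.∘ θ x)
  lift-naturality {h = h} {h′} α θ θ-lifts {x} {y} f = begin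
    F₁ F (θ y C.∘ F₁ h f)          ≈⟨ homomorphism F ⟩
    F₁ F (θ y) ∘ F₁ F (F₁ h f)     ≈⟨ D.∘-resp-≈ˡ (θ-lifts y) ⟩
    η α y ∘ F₁ F (F₁ h f)          ≈⟨ commute α f ⟩
    F₁ F (F₁ h′ f) ∘ η α x         ≈⟨ D.∘-resp-≈ʳ (θ-lifts x) ⟨
    F₁ F (F₁ h′ f) ∘ F₁ F (θ x)    ≈⟨ homomorphism F ⟨
    F₁ F (F₁ h′ f C.∘ θ x)         ∎

invertNT : ∀ {o ℓ e} {X C : Groupoid o ℓ e} {F G : Functor X C} → NatTrans F G → NatTrans G F
invertNT {C = C} α = record { η = λ x → η α x ⁻¹ ; commute = λ f → ⁻¹-square (commute α f) }
  where open GroupoidProperties C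

Interval : ∀ {o ℓ e} → Groupoid o ℓ e
Interval {o} {ℓ} {e} = record
  { Obj = Lift o Bool ; _⇒_ = λ _ _ → Lift ℓ ⊤ ; _≈_ = λ _ _ → Lift e ⊤
  ; id = lift tt ; _∘_ = λ _ _ → lift tt ; _⁻¹ = λ _ → lift tt
  ; equiv = record { refl = lift tt ; sym = λ _ → lift tt ; trans = λ _ _ → lift tt }
  ; assoc = lift tt ; identityˡ = lift tt ; identityʳ = lift tt
  ; ∘-resp-≈ = λ _ _ → lift tt ; inverseˡ = lift tt ; inverseʳ = lift tt }

pattern i₀ = lift false
pattern i₁ = lift true

module _ {o ℓ e} (C : Groupoid o ℓ e) {a b : Groupoid.Obj C} (m : Groupoid._⇒_ C a b) where
  open GroupoidProperties C

  private
    end : Lift o Bool → Obj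
    end i₀ = a
    end i₁ = b

    walk : ∀ i j → end i ⇒ end j
    walk i₀ i₀ = id
    walk i₀ i₁ = m
    walk i₁ i₀ = m ⁻¹
    walk i₁ i₁ = id

    walk-id : ∀ i → walk i i ≈ id
    walk-id i₀ = ≈-refl
    walk-id i₁ = ≈-refl

    walk-∘ : ∀ i j k → walk i k ≈ walk j k ∘ walk i j
    walk-∘ i₀ i₀ k  = ≈-sym identityʳ
    walk-∘ i₁ i₁ k  = ≈-sym identityʳ
    walk-∘ i₀ i₁ i₀ = ≈-sym inverseˡ
    walk-∘ i₀ i₁ i₁ = ≈-sym identityˡ
    walk-∘ i₁ i₀ i₀ = ≈-sym identityˡ
    walk-∘ i₁ i₀ i₁ = ≈-sym inverseʳ

  path : Functor Interval C
  path = record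
    { F₀ = end
    ; F₁ = λ {i} {j} _ → walk i j
    ; identity = λ {i} → walk-id i
    ; homomorphism = λ {i} {j} {k} → walk-∘ i j k
    ; F-resp-≈ = λ _ → ≈-refl
    }

Interval-strictEq : ∀ {o ℓ e} {C : Groupoid o ℓ e} (F G : Functor Interval C)
                    (e₀ : F₀ F i₀ ≡ F₀ G i₀) (e₁ : F₀ F i₁ ≡ F₀ G i₁) →
                    let open Groupoid C in
                    idTo C e₁ ∘ F₁ F {i₀} {i₁} _ ≈ F₁ G {i₀} {i₁} _ ∘ idTo C e₀ →
                    StrictEq F G
Interval-strictEq {C = C} F G e₀ e₁ square = record { eq₀ = eq₀′ ; eq₁ = λ {i} {j} _ → eq₁′ i j }
  where
  open GroupoidProperties C
  open HomReasoning
  module F = FunctorProperties F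
  module G = FunctorProperties G

  eq₀′ : ∀ i → F₀ F i ≡ F₀ G i
  eq₀′ i₀ = e₀
  eq₀′ i₁ = e₁

  eq₁′ : ∀ i j → idTo C (eq₀′ j) ∘ F₁ F {i} {j} _ ≈ F₁ G {i} {j} _ ∘ idTo C (eq₀′ i)
  eq₁′ i₀ i₀ = idTo-square-ids e₀ (identity F) (identity G)
  eq₁′ i₁ i₁ = idTo-square-ids e₁ (identity F) (identity G)
  eq₁′ i₀ i₁ = square
  eq₁′ i₁ i₀ = begin
    idTo C e₀ ∘ F₁ F {i₁} {i₀} _      ≈⟨ ∘-resp-≈ʳ F.F-resp-⁻¹ ⟩
    idTo C e₀ ∘ F₁ F {i₀} {i₁} _ ⁻¹   ≈⟨ ⁻¹-square (≈-sym square) ⟨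
    F₁ G {i₀} {i₁} _ ⁻¹ ∘ idTo C e₁   ≈⟨ ∘-resp-≈ˡ G.F-resp-⁻¹ ⟨
    F₁ G {i₁} {i₀} _ ∘ idTo C e₁      ∎

strictEq-refl : ∀ {o ℓ e} {X C : Groupoid o ℓ e} (F : Functor X C) → StrictEq F F
strictEq-refl {C = C} F = record
  { eq₀ = λ _ → refl ; eq₁ = λ _ → id-square ≈-refl }
  where open GroupoidProperties C

module PullbackProperties {o ℓ e} {S B T : Groupoid o ℓ e} {u : Functor S B} {v : Functor T B}
                          {P : Groupoid o ℓ e} {l : Functor P S} {r : Functor P T}
                          (pb : IsPullback u v P l r) where
  open IsPullback pb
  private
    module S = GroupoidProperties S
    module T = GroupoidProperties T
    module B = GroupoidProperties B
  open GroupoidProperties P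

  commutes▹ : ∀ {X : Groupoid o ℓ e} (h : Functor X P) → StrictEq (u ∘F (l ∘F h)) (v ∘F (r ∘F h))
  commutes▹ h = record { eq₀ = λ x → eq₀ commutes (F₀ h x) ; eq₁ = λ f → eq₁ commutes (F₁ h f) }

  jointly-monic : ∀ {X : Groupoid o ℓ e} (h h′ : Functor X P) →
                  StrictEq (l ∘F h) (l ∘F h′) → StrictEq (r ∘F h) (r ∘F h′) →
                  ∃[ k ] StrictEq h k × StrictEq h′ k
  jointly-monic {X} h h′ hl hr =
    let (k , _ , _ , unique) = universal X (l ∘F h′) (r ∘F h′) (commutes▹ h′)
    in k , unique h hl hr , unique h′ (strictEq-refl _) (strictEq-refl _)

  jointly-injective : ∀ {p q} → F₀ l p ≡ F₀ l q → F₀ r p ≡ F₀ r q → p ≡ q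
  jointly-injective {p} {q} el er =
    let (_ , hp , hq) = jointly-monic (path P (id {p})) (path P (id {q}))
                          (Interval-strictEq _ _ el el (S.idTo-square-ids el (identity l) (identity l)))
                          (Interval-strictEq _ _ er er (T.idTo-square-ids er (identity r) (identity r)))
    in ≡.trans (eq₀ hp i₀) (≡.sym (eq₀ hq i₀))

  jointly-faithful : ∀ {p q} (f g : p ⇒ q) → F₁ l f S.≈ F₁ l g → F₁ r f T.≈ F₁ r g → f ≈ g
  jointly-faithful f g fl≈gl fr≈gr =
    let (_ , hf , hg) = jointly-monic (path P f) (path P g)
                          (Interval-strictEq _ _ refl refl (S.id-square fl≈gl))
                          (Interval-strictEq _ _ refl refl (T.id-square fr≈gr))
    in idTo-square-unique (eq₀ hf i₀) (eq₀ hg i₀) (eq₀ hf i₁) (eq₀ hg i₁)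
         (eq₁ hf {i₀} {i₁} _) (eq₁ hg {i₀} {i₁} _)

  jointly-full : ∀ {p q} (s : F₀ l p S.⇒ F₀ l q) (t : F₀ r p T.⇒ F₀ r q) →
                 idTo B (eq₀ commutes q) B.∘ F₁ u s B.≈ F₁ v t B.∘ idTo B (eq₀ commutes p) →
                 Σ[ k ∈ p ⇒ q ] F₁ l k S.≈ s × F₁ r k T.≈ t
  jointly-full {p} {q} s t square =
    let (k , kl , kr , _) = universal Interval (path S s) (path T t)
                              (Interval-strictEq _ _ (eq₀ commutes p) (eq₀ commutes q) square)
        end₀ = jointly-injective (eq₀ kl i₀) (eq₀ kr i₀)
        end₁ = jointly-injective (eq₀ kl i₁) (eq₀ kr i₁)
    in subst₂ _⇒_ end₀ end₁ (F₁ k {i₀} {i₁} _)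
       , FunctorProperties.F₁-subst₂ l end₀ end₁ (eq₀ kl i₀) (eq₀ kl i₁) (eq₁ kl _)
       , FunctorProperties.F₁-subst₂ r end₀ end₁ (eq₀ kr i₀) (eq₀ kr i₁) (eq₁ kr _)

  μ : NatTrans (u ∘F l) (v ∘F r)
  μ = idNT commutes

  Φ-faithful : ∀ {X : Groupoid o ℓ e} {h h′ : Functor X P} (θ θ′ : NatTrans h h′) →
               (∀ x → F₁ l (η θ x) S.≈ F₁ l (η θ′ x)) →
               (∀ x → F₁ r (η θ x) T.≈ F₁ r (η θ′ x)) → θ ≈NT θ′
  Φ-faithful θ θ′ θl≈θ′l θr≈θ′r x = jointly-faithful _ _ (θl≈θ′l x) (θr≈θ′r x)

  Φ-full : ∀ {X : Groupoid o ℓ e} {h h′ : Functor X P}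
           (m : ConeMor u v (Φ₀ u v l r μ h) (Φ₀ u v l r μ h′)) →
           Σ[ θ ∈ NatTrans h h′ ] ((∀ x → F₁ l (η θ x) S.≈ η (α m) x) ×
                                   (∀ x → F₁ r (η θ x) T.≈ η (β m) x))
  Φ-full {h = h} {h′} m = θ , θl≈α , θr≈β
    where
    lifts : ∀ x → Σ[ k ∈ F₀ h x ⇒ F₀ h′ x ] F₁ l k S.≈ η (α m) x × F₁ r k T.≈ η (β m) x
    lifts x = jointly-full (η (α m) x) (η (β m) x) (compat m x)

    θl≈α : ∀ x → F₁ l (proj₁ (lifts x)) S.≈ η (α m) x
    θl≈α x = proj₁ (proj₂ (lifts x))

    θr≈β : ∀ x → F₁ r (proj₁ (lifts x)) T.≈ η (β m) x
    θr≈β x = proj₂ (proj₂ (lifts x))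

    θ : NatTrans h h′
    θ = record
      { η = λ x → proj₁ (lifts x)
      ; commute = λ f → jointly-faithful _ _
          (FunctorProperties.lift-naturality l (α m) _ θl≈α f)
          (FunctorProperties.lift-naturality r (β m) _ θr≈β f)
      }

module _ {o ℓ e} {S B T : Groupoid o ℓ e} {u : Functor S B} {v : Functor T B}
         {P : Groupoid o ℓ e} {l : Functor P S} {r : Functor P T} {μ : NatTrans (u ∘F l) (v ∘F r)}
         {X : Groupoid o ℓ e} {c : PseudoCone u v X} {h : Functor X P} where
  open GroupoidProperties B
  open HomReasoning
  private
    module u = FunctorProperties u
    module v = FunctorProperties v

  Factorisation : Set (o ⊔ ℓ ⊔ e)
  Factorisation =
    Σ[ a ∈ NatTrans (l′ c) (l ∘F h) ] Σ[ b ∈ NatTrans (r ∘F h) (r′ c) ]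
      (∀ x → η (ν c) x ≈ F₁ v (η b x) ∘ (η μ (F₀ h x) ∘ F₁ u (η a x)))

  coneIso⇒factorisation : ConeIso u v (Φ₀ u v l r μ h) c → Factorisation
  coneIso⇒factorisation iso = α from , β to , factorise
    where
    open ConeIso iso
    factorise : ∀ x → η (ν c) x ≈ F₁ v (η (β to) x) ∘ (η μ (F₀ h x) ∘ F₁ u (η (α from) x))
    factorise x = begin
      η (ν c) x                                                   ≈⟨ identityʳ ⟨
      η (ν c) x ∘ id                                              ≈⟨ ∘-resp-≈ʳ (identity u) ⟨
      η (ν c) x ∘ F₁ u (Groupoid.id S)                            ≈⟨ ∘-resp-≈ʳ (F-resp-≈ u (isoʳ x)) ⟨
      η (ν c) x ∘ F₁ u (Groupoid._∘_ S (η (α to) x) (η (α from) x)) ≈⟨ ∘-resp-≈ʳ (homomorphism u) ⟩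
      η (ν c) x ∘ (F₁ u (η (α to) x) ∘ F₁ u (η (α from) x))       ≈⟨ sym-assoc ⟩
      (η (ν c) x ∘ F₁ u (η (α to) x)) ∘ F₁ u (η (α from) x)       ≈⟨ ∘-resp-≈ˡ (compat to x) ⟩
      (F₁ v (η (β to) x) ∘ η μ (F₀ h x)) ∘ F₁ u (η (α from) x)    ≈⟨ assoc ⟩
      F₁ v (η (β to) x) ∘ (η μ (F₀ h x) ∘ F₁ u (η (α from) x))    ∎

  factorisation⇒coneIso : Factorisation → ConeIso u v (Φ₀ u v l r μ h) c
  factorisation⇒coneIso (a , b , factorise) = record
    { to = record { α = invertNT a ; β = b ; compat = to-compat }
    ; from = record { α = a ; β = invertNT b ; compat = from-compat }
    ; isoˡ = λ _ → Groupoid.inverseʳ S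
    ; isoʳ = λ _ → Groupoid.inverseˡ S
    ; isoˡ′ = λ _ → Groupoid.inverseˡ T
    ; isoʳ′ = λ _ → Groupoid.inverseʳ T
    }
    where
    ua = λ x → F₁ u (η a x)
    vb = λ x → F₁ v (η b x)
    μh = λ x → η μ (F₀ h x)

    to-compat : ∀ x → η (ν c) x ∘ F₁ u (Groupoid._⁻¹ S (η a x)) ≈ vb x ∘ μh x
    to-compat x = begin
      η (ν c) x ∘ F₁ u (Groupoid._⁻¹ S (η a x))    ≈⟨ ∘-resp-≈ˡ (factorise x) ⟩
      (vb x ∘ (μh x ∘ ua x)) ∘ F₁ u (Groupoid._⁻¹ S (η a x)) ≈⟨ assoc ⟩
      vb x ∘ ((μh x ∘ ua x) ∘ F₁ u (Groupoid._⁻¹ S (η a x))) ≈⟨ ∘-resp-≈ʳ assoc ⟩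
      vb x ∘ (μh x ∘ (ua x ∘ F₁ u (Groupoid._⁻¹ S (η a x)))) ≈⟨ ∘-resp-≈ʳ (∘-resp-≈ʳ u.F-inverseʳ) ⟩
      vb x ∘ (μh x ∘ id)                           ≈⟨ ∘-resp-≈ʳ identityʳ ⟩
      vb x ∘ μh x                                  ∎

    from-compat : ∀ x → μh x ∘ ua x ≈ F₁ v (Groupoid._⁻¹ T (η b x)) ∘ η (ν c) x
    from-compat x = begin
      μh x ∘ ua x                                    ≈⟨ identityˡ ⟨
      id ∘ (μh x ∘ ua x)                             ≈⟨ ∘-resp-≈ˡ v.F-inverseˡ ⟨
      (F₁ v (Groupoid._⁻¹ T (η b x)) ∘ vb x) ∘ (μh x ∘ ua x) ≈⟨ assoc ⟩
      F₁ v (Groupoid._⁻¹ T (η b x)) ∘ (vb x ∘ (μh x ∘ ua x)) ≈⟨ ∘-resp-≈ʳ (factorise x) ⟨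
      F₁ v (Groupoid._⁻¹ T (η b x)) ∘ η (ν c) x      ∎

proposition9 : ∀ {o ℓ e} {S B T : Groupoid o ℓ e} (u : Functor S B) (v : Functor T B)
                 (P : Groupoid o ℓ e) (l : Functor P S) (r : Functor P T)
                 (pb : IsPullback u v P l r) →
                 IsBipullback u v l r (idNT (IsPullback.commutes pb))
                   ⇔ LiftCondition u v l r (idNT (IsPullback.commutes pb))
proposition9 u v P l r pb = mk⇔ bipullback⇒lift lift⇒bipullback
  where
  open PullbackProperties pb

  bipullback⇒lift : IsBipullback u v l r μ → LiftCondition u v l r μ
  bipullback⇒lift bp X c =
    let (h , iso) = IsBipullback.essSurj bp X c in h , coneIso⇒factorisation {l = l} {r = r} {μ = μ} {h = h} iso

  lift⇒bipullback : LiftCondition u v l r μ → IsBipullback u v l r μ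
  lift⇒bipullback lc = record
    { essSurj = λ X c → let (h , fac) = lc X c in h , factorisation⇒coneIso {l = l} {r = r} {μ = μ} {h = h} fac
    ; full = λ X h h′ → Φ-full
    ; faithful = λ X h h′ → Φ-faithful
    }
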